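{- Let $m$ be a positive integer and let $\Gamma=\mathrm{Cay}(\mathbb{Z}_{2m},S)$ be an unstable circulant graph. If the Cayley graph $\mathrm{Cay}(2\mathbb{Z}_{2m},S\cap 2\mathbb{Z}_{2m})$ is stable, then $\Gamma$ is of Type II, i.e. for every TF-morphism $(\alpha,\beta)$ of $\Gamma$ with $\alpha\ne\beta$, at least one of $\alpha,\beta$ does not map $2\mathbb{Z}_{2m}$ onto itself.
   Context: For an additive group $G$ and an inverse-closed subset $T\subseteq G\setminus\{0\}$, the Cayley graph $\mathrm{Cay}(G,T)$ has vertex set $G$ with $x\sim y$ iff $y-x\in T$. $2\mathbb{Z}_{2m}=\{2x:x\in\mathbb{Z}_{2m}\}$ is the subgroup of even residues. A TF-morphism of a graph $\Lambda$ is a pair $(\alpha,\beta)$ of permutations of $V(\Lambda)$ such that $u\sim_\Lambda v$ implies $u^\alpha\sim_\Lambda v^\beta$ ($u^\alpha$ is the image of $u$ under $\alpha$). A graph $\Lambda$ is stable if $\mathrm{Aut}(\Lambda\times K_2)=\mathrm{Aut}(\Lambda)\times\mathrm{Aut}(K_2)$, where $\Lambda\times K_2$ is the direct product (vertex set $V(\Lambda)\times V(K_2)$, $(a,x)\sim(b,y)$ iff $a\sim b$ and $x\sim y$) on which $\mathrm{Aut}(\Lambda)\times\mathrm{Aut}(K_2)$ acts coordinatewise; otherwise $\Lambda$ is unstable. -}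

module Defs where

open import Level using (0ℓ)
open import Data.Nat using (ℕ; zero; suc; _+_; _*_; _∸_; _%_)
open import Data.Nat.DivMod using (_mod_)
open import Data.Fin using (Fin; toℕ)
open import Data.Fin.Subset using (Subset; _∈_; _∉_)
open import Data.Bool using (Bool; true; false)
open import Data.Product using (Σ; ∃; _×_; _,_; proj₁)
open import Function.Bundles using (_↔_; Inverse)
open import Relation.Binary.PropositionalEquality using (_≡_; _≢_)
open import Relation.Nullary using (¬_)

record Graph : Set₁ where
  field
    V   : Set
    _~_ : V → V → Set
open Graph public

-- sub x y  =  y - x  (mod n)
sub : ∀ {n} → Fin n → Fin n → Fin n
sub {suc k} x y = (toℕ y + (suc k ∸ toℕ x)) mod suc k

neg : ∀ {n} → Fin n → Fin n
neg {suc k} x = (suc k ∸ toℕ x) mod suc k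

zeroZ : ∀ {n} → Fin n → Fin n
zeroZ x = sub x x

InverseClosed : ∀ {n} → Subset n → Set
InverseClosed S = ∀ s → s ∈ S → neg s ∈ S

IsConnectionSet : ∀ {n} → Subset n → Set
IsConnectionSet S = InverseClosed S × (∀ x → zeroZ x ∉ S)

Cay : (n : ℕ) → Subset n → Graph
Cay n S = record { V = Fin n ; _~_ = λ x y → sub x y ∈ S }

-- 2ℤ_{2m}: the even residues of ℤ_{2m} (2m is even, so this is well defined).
IsEven : ∀ {n} → Fin n → Set
IsEven x = toℕ x % 2 ≡ 0

EvenZ : ℕ → Set
EvenZ n = Σ (Fin n) IsEven

CayEven : (n : ℕ) → Subset n → Graph
CayEven n S = record
  { V   = EvenZ n
  ; _~_ = λ x y → (sub (proj₁ x) (proj₁ y) ∈ S) × IsEven (sub (proj₁ x) (proj₁ y)) }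

K₂ : Graph
K₂ = record { V = Bool ; _~_ = λ x y → x ≢ y }

_×K₂ : Graph → Graph
Λ ×K₂ = record
  { V   = V Λ × Bool
  ; _~_ = λ { (a , x) (b , y) → (_~_ Λ a b) × (x ≢ y) } }

record Aut (Λ : Graph) : Set where
  field
    perm     : V Λ ↔ V Λ
    preserve : ∀ u v → (_~_ Λ u v → _~_ Λ (Inverse.to perm u) (Inverse.to perm v))
                     × (_~_ Λ (Inverse.to perm u) (Inverse.to perm v) → _~_ Λ u v)
open Aut public

-- Stable: every automorphism of Λ × K₂ is of the form (a , x) ↦ (g a , h x)
-- with g ∈ Aut Λ and h ∈ Aut K₂ (the reverse inclusion always holds).
Stable : Graph → Set
Stable Λ = (f : Aut (Λ ×K₂)) →
  Σ (Aut Λ) λ g → Σ (Aut K₂) λ h →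
    ∀ a x → Inverse.to (perm f) (a , x) ≡ (Inverse.to (perm g) a , Inverse.to (perm h) x)

Unstable : Graph → Set
Unstable Λ = ¬ Stable Λ

record TFMorphism (Λ : Graph) : Set where
  field
    α : V Λ ↔ V Λ
    β : V Λ ↔ V Λ
    hom : ∀ u v → _~_ Λ u v → _~_ Λ (Inverse.to α u) (Inverse.to β v)
open TFMorphism public

MapsEvenOnto : ∀ {n} → Fin n ↔ Fin n → Set
MapsEvenOnto {n} α =
  (∀ x → IsEven x → IsEven (Inverse.to α x)) ×
  (∀ y → IsEven y → ∃ λ x → IsEven x × (Inverse.to α x ≡ y))

TypeII : (n : ℕ) → Subset n → Set
TypeII n S = (t : TFMorphism (Cay n S)) →
  ¬ (∀ x → Inverse.to (α t) x ≡ Inverse.to (β t) x) →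
  ¬ (MapsEvenOnto (α t) × MapsEvenOnto (β t))

{-# OPTIONS --safe #-}

-- Let (α, β) be a TF-morphism of Γ = Cay(ℤ_{2m}, S) whose components map 2ℤ_{2m} onto itself and let
-- Δ = Cay(2ℤ_{2m}, S ∩ 2ℤ_{2m}). Since Γ is finite, (α, β) maps the edges of Γ onto the edges, so it
-- also reflects adjacency; restricted to the even residues it is therefore a TF-automorphism of Δ,
-- i.e. (u, 0) ↦ (α u, 0), (u, 1) ↦ (β u, 1) is an automorphism of Δ × K₂. Stability of Δ makes this
-- automorphism a product, whence α = β on the even residues. As α and β preserve parity, conjugating
-- (α, β) by any translation yields another such TF-morphism, and evaluating it at 0 gives α = β.

module Submission where

open import Defs
open import Data.Nat using (ℕ; _*_; _≥_)
open import Data.Fin.Subset using (Subset)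

open import Level using (Level; 0ℓ)
open import Data.Bool using (Bool; true; false)
open import Data.Nat using (zero; suc; _+_; _∸_; _%_; _≤_; _<_; z≤n; s≤s; NonZero)
open import Data.Nat.Properties
  using (≤-refl; <-irrefl; +-mono-≤; +-mono-<-≤; +-mono-≤-<; +-assoc; +-comm; +-identityʳ;
         m+[n∸m]≡n; m∸n+n≡m; ≡-irrelevant)
open import Data.Nat.DivMod
  using (_mod_; %-distribˡ-+; m%n%n≡m%n; [m+n]%n≡m%n; m%n<n; m<n⇒m%n≡m; m∣n⇒o%n%m≡o%m)
open import Data.Nat.Divisibility using (_∣_; m∣m*n)
open import Data.Fin using (Fin; zero; suc; toℕ)
open import Data.Fin.Properties using (toℕ-injective; toℕ<n; toℕ≤n; toℕ-fromℕ<; *↔×)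
open import Data.Fin.Subset using (_∈_)
open import Data.Fin.Subset.Properties using (_∈?_)
open import Data.Product using (_×_; _,_; proj₁; proj₂; uncurry)
open import Data.Product.Properties using (Σ-≡,≡→≡)
open import Data.Product.Function.NonDependent.Propositional using (_×-↔_)
open import Algebra.Properties.CommutativeMonoid.Sum Data.Nat.Properties.+-0-commutativeMonoid
  using (sum; sum-permute; sum-cong-≗)
open import Function using (_∘_)
open import Relation.Binary.Bundles using (Setoid)
import Relation.Binary.Reasoning.Setoid as SetoidReasoning
open import Function.Bundles using (_↔_; Inverse; Injection; mk↔ₛ′)
open import Function.Construct.Composition using (_↔-∘_)
open import Function.Construct.Symmetry using (↔-sym)
open import Function.Properties.Inverse using (↔-refl; ↔⇒↣)
open import Relation.Nullary using (¬_; Dec; yes; no; contradiction)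
open import Relation.Nullary.Decidable using (decidable-stable)
open import Relation.Unary using (Pred)
open import Relation.Binary.Definitions using () renaming (Decidable to Decidable₂)
open import Relation.Unary using (Decidable)
open import Relation.Binary.PropositionalEquality
  using (_≡_; refl; sym; trans; cong; cong₂; subst; subst₂; module ≡-Reasoning)

open Inverse using (to; from; strictlyInverseˡ; strictlyInverseʳ)

private
  variable
    ℓ ℓ′ : Level
    A B : Set ℓ

indicator : Dec A → ℕ
indicator (yes _) = 1
indicator (no _)  = 0

indicator-mono : (A → B) → (a? : Dec A) (b? : Dec B) → indicator a? ≤ indicator b?
indicator-mono f (yes x) (yes _) = ≤-refl
indicator-mono f (yes x) (no ¬y) = contradiction (f x) ¬y
indicator-mono f (no _)  _       = z≤n

indicator-< : ¬ A → B → (a? : Dec A) (b? : Dec B) → indicator a? < indicator b?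
indicator-< ¬x y (yes x) _       = contradiction x ¬x
indicator-< ¬x y (no _)  (yes _) = s≤s z≤n
indicator-< ¬x y (no _)  (no ¬y) = contradiction y ¬y

sum-mono-≤ : ∀ {M} {f g : Fin M → ℕ} → (∀ i → f i ≤ g i) → sum f ≤ sum g
sum-mono-≤ {zero}  f≤g = z≤n
sum-mono-≤ {suc M} f≤g = +-mono-≤ (f≤g zero) (sum-mono-≤ (f≤g ∘ suc))

sum-mono-< : ∀ {M} {f g : Fin M → ℕ} → (∀ i → f i ≤ g i) → ∀ j → f j < g j → sum f < sum g
sum-mono-< f≤g zero    fj<gj = +-mono-<-≤ fj<gj (sum-mono-≤ (f≤g ∘ suc))
sum-mono-< f≤g (suc j) fj<gj = +-mono-≤-< (f≤g zero) (sum-mono-< (f≤g ∘ suc) j fj<gj)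

-- If φ mapped some x with ¬ P x into P, then more elements would satisfy P ∘ φ than P,
-- whereas the two counts agree because φ is a bijection.
preserved⇒reflected : ∀ {M} → A ↔ Fin M → (φ : A ↔ A) {P : Pred A ℓ′} → Decidable P →
  (∀ x → P x → P (to φ x)) → ∀ x → P (to φ x) → P x
preserved⇒reflected {A = A} e φ {P} P? preserves x Pφx =
  decidable-stable (P? x) λ ¬Px → <-irrefl counts-agree
    (sum-mono-< (λ i → indicator-mono (preserves _) _ _) (to e x)
      (indicator-< (¬Px ∘ subst P (strictlyInverseʳ e x))
                   (subst (P ∘ to φ) (sym (strictlyInverseʳ e x)) Pφx) _ _))
  where
  count : A → ℕ
  count y = indicator (P? y)

  counts-agree : sum (count ∘ from e) ≡ sum (count ∘ to φ ∘ from e)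
  counts-agree = trans (sum-permute (count ∘ from e) (e ↔-∘ (φ ↔-∘ ↔-sym e)))
                       (sum-cong-≗ λ i → cong count (strictlyInverseʳ e (to φ (from e i))))

tf-reflects : ∀ {M} (Λ : Graph) → V Λ ↔ Fin M → Decidable₂ (_~_ Λ) → (t : TFMorphism Λ) →
  ∀ u v → _~_ Λ (to (α t) u) (to (β t) v) → _~_ Λ u v
tf-reflects Λ e _~?_ t u v =
  preserved⇒reflected (↔-sym *↔× ↔-∘ (e ×-↔ e)) (α t ×-↔ β t) {uncurry (_~_ Λ)}
    (uncurry _~?_) (uncurry (hom t)) (u , v)

module _ (Λ : Graph) (~-sym : ∀ u v → _~_ Λ u v → _~_ Λ v u) (α β : V Λ ↔ V Λ)
         (α~β : ∀ u v → _~_ Λ u v → _~_ Λ (to α u) (to β v))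
         (α~β⇒~ : ∀ u v → _~_ Λ (to α u) (to β v) → _~_ Λ u v) where

  private
    select : Bool → V Λ ↔ V Λ
    select true  = α
    select false = β

    twist : (V Λ × Bool) ↔ (V Λ × Bool)
    twist = mk↔ₛ′ (λ (u , b) → to (select b) u , b) (λ (u , b) → from (select b) u , b)
                  (λ (u , b) → cong (_, b) (strictlyInverseˡ (select b) u))
                  (λ (u , b) → cong (_, b) (strictlyInverseʳ (select b) u))

    twist-preserves : ∀ p q → (_~_ (Λ ×K₂) p q → _~_ (Λ ×K₂) (to twist p) (to twist q))
                            × (_~_ (Λ ×K₂) (to twist p) (to twist q) → _~_ (Λ ×K₂) p q)
    twist-preserves (u , true)  (v , false) =
      (λ (u~v , b≢c) → α~β u v u~v , b≢c) , (λ (αu~βv , b≢c) → α~β⇒~ u v αu~βv , b≢c)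
    twist-preserves (u , false) (v , true)  =
      (λ (u~v , b≢c) → ~-sym (to α v) (to β u) (α~β v u (~-sym u v u~v)) , b≢c) ,
      (λ (βu~αv , b≢c) → ~-sym v u (α~β⇒~ v u (~-sym (to β u) (to α v) βu~αv)) , b≢c)
    twist-preserves (u , true)  (v , true)  = (λ (_ , b≢b) → contradiction refl b≢b) ,
                                              (λ (_ , b≢b) → contradiction refl b≢b)
    twist-preserves (u , false) (v , false) = (λ (_ , b≢b) → contradiction refl b≢b) ,
                                              (λ (_ , b≢b) → contradiction refl b≢b)

  -- Stability writes twist as g × h, so α and β both agree with g.
  stable⇒twofold-trivial : Stable Λ → ∀ x → to α x ≡ to β x
  stable⇒twofold-trivial stable x =
    let (_ , _ , twist≡g×h) = stable record { perm = twist ; preserve = twist-preserves }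
    in trans (cong proj₁ (twist≡g×h x true)) (sym (cong proj₁ (twist≡g×h x false)))

conjugate : ∀ {Λ} → Aut Λ → TFMorphism Λ → TFMorphism Λ
conjugate {Λ} π t = record
  { α   = ↔-sym (perm π) ↔-∘ (α t ↔-∘ perm π)
  ; β   = ↔-sym (perm π) ↔-∘ (β t ↔-∘ perm π)
  ; hom = λ u v u~v → from-preserves (hom t _ _ (proj₁ (preserve π u v) u~v))
  }
  where
  from-preserves : ∀ {u v} → _~_ Λ u v → _~_ Λ (from (perm π) u) (from (perm π) v)
  from-preserves {u} {v} u~v = proj₂ (preserve π _ _)
    (subst₂ (_~_ Λ) (sym (strictlyInverseˡ (perm π) u)) (sym (strictlyInverseˡ (perm π) v)) u~v)

infix 4 _≡_[mod_]
record _≡_[mod_] (m n d : ℕ) .{{_ : NonZero d}} : Set where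
  constructor mk-mod
  field mod-% : m % d ≡ n % d
open _≡_[mod_]

module _ {d : ℕ} .{{_ : NonZero d}} where

  ≡-mod-setoid : Setoid 0ℓ 0ℓ
  ≡-mod-setoid = record
    { Carrier       = ℕ
    ; _≈_           = _≡_[mod d ]
    ; isEquivalence = record
      { refl  = mk-mod refl
      ; sym   = λ (mk-mod m≡n) → mk-mod (sym m≡n)
      ; trans = λ (mk-mod m≡n) (mk-mod n≡o) → mk-mod (trans m≡n n≡o)
      }
    }

  module ≡-mod-Reasoning = SetoidReasoning ≡-mod-setoid

  +d-≡-mod : ∀ m → m + d ≡ m [mod d ]
  +d-≡-mod m = mk-mod ([m+n]%n≡m%n m d)

  +-cong-mod : ∀ {m m′ n n′} → m ≡ m′ [mod d ] → n ≡ n′ [mod d ] → m + n ≡ m′ + n′ [mod d ]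
  +-cong-mod {m} {m′} {n} {n′} (mk-mod m≡m′) (mk-mod n≡n′) = mk-mod (begin
    (m + n) % d            ≡⟨ %-distribˡ-+ m n d ⟩
    (m % d + n % d) % d    ≡⟨ cong₂ (λ a b → (a + b) % d) m≡m′ n≡n′ ⟩
    (m′ % d + n′ % d) % d  ≡⟨ %-distribˡ-+ m′ n′ d ⟨
    (m′ + n′) % d          ∎)
    where open ≡-Reasoning

  +-congˡ-mod : ∀ m {n n′} → n ≡ n′ [mod d ] → m + n ≡ m + n′ [mod d ]
  +-congˡ-mod m = +-cong-mod (mk-mod refl)

  +-congʳ-mod : ∀ {m m′} n → m ≡ m′ [mod d ] → m + n ≡ m′ + n [mod d ]
  +-congʳ-mod n m≡m′ = +-cong-mod m≡m′ (mk-mod refl)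

  +-cancelʳ-mod : ∀ {m n c} → c ≤ d → m + c ≡ n + c [mod d ] → m ≡ n [mod d ]
  +-cancelʳ-mod {m} {n} {c} c≤d m+c≡n+c = begin
    m                    ≈⟨ add-complement m ⟨
    m + c + (d ∸ c)      ≈⟨ +-congʳ-mod (d ∸ c) m+c≡n+c ⟩
    n + c + (d ∸ c)      ≈⟨ add-complement n ⟩
    n                    ∎
    where
    open ≡-mod-Reasoning
    add-complement : ∀ l → l + c + (d ∸ c) ≡ l [mod d ]
    add-complement l = begin
      l + c + (d ∸ c)    ≡⟨ +-assoc l c _ ⟩
      l + (c + (d ∸ c))  ≡⟨ cong (l +_) (m+[n∸m]≡n c≤d) ⟩
      l + d              ≈⟨ +d-≡-mod l ⟩
      l                  ∎

  ≡-mod-divisor : ∀ {e m n} .{{_ : NonZero e}} → e ∣ d → m ≡ n [mod d ] → m ≡ n [mod e ]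
  ≡-mod-divisor {e} {m} {n} e∣d (mk-mod m≡n) = mk-mod (begin
    m % e      ≡⟨ m∣n⇒o%n%m≡o%m e d m e∣d ⟨
    m % d % e  ≡⟨ cong (_% e) m≡n ⟩
    n % d % e  ≡⟨ m∣n⇒o%n%m≡o%m e d n e∣d ⟩
    n % e      ∎)
    where open ≡-Reasoning

  toℕ-mod : ∀ m → toℕ (m mod d) ≡ m [mod d ]
  toℕ-mod m = mk-mod (trans (cong (_% d) (toℕ-fromℕ< (m%n<n m d))) (m%n%n≡m%n m d))

  ≡-mod⇒≡ : (x y : Fin d) → toℕ x ≡ toℕ y [mod d ] → x ≡ y
  ≡-mod⇒≡ x y (mk-mod x≡y) = toℕ-injective (begin
    toℕ x      ≡⟨ m<n⇒m%n≡m (toℕ<n x) ⟨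
    toℕ x % d  ≡⟨ x≡y ⟩
    toℕ y % d  ≡⟨ m<n⇒m%n≡m (toℕ<n y) ⟩
    toℕ y      ∎)
    where open ≡-Reasoning

parity-≡ : ∀ m n → (m % 2 ≡ 0 → n % 2 ≡ 0) → (n % 2 ≡ 0 → m % 2 ≡ 0) → m % 2 ≡ n % 2
parity-≡ (suc (suc m)) n m⇒n n⇒m = parity-≡ m n m⇒n n⇒m
parity-≡ m (suc (suc n)) m⇒n n⇒m = parity-≡ m n m⇒n n⇒m
parity-≡ 0 0 _   _   = refl
parity-≡ 0 1 m⇒n _   = contradiction (m⇒n refl) λ ()
parity-≡ 1 0 _   n⇒m = contradiction (n⇒m refl) λ ()
parity-≡ 1 1 _   _   = refl

ParityPreserving : ∀ {n} → Fin n ↔ Fin n → Set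
ParityPreserving γ = ∀ x → toℕ (to γ x) ≡ toℕ x [mod 2 ]

mapsEvenOnto⇒parityPreserving : ∀ {n} (γ : Fin n ↔ Fin n) → MapsEvenOnto γ → ParityPreserving γ
mapsEvenOnto⇒parityPreserving γ (preserves , onto) x =
  mk-mod (parity-≡ (toℕ (to γ x)) (toℕ x) reflects (preserves x))
  where
  reflects : IsEven (to γ x) → IsEven x
  reflects γx-even = let (x′ , x′-even , γx′≡γx) = onto (to γ x) γx-even
                     in subst IsEven (Injection.injective (↔⇒↣ γ) γx′≡γx) x′-even

EvenZ-≡ : ∀ {n} {x y : EvenZ n} → proj₁ x ≡ proj₁ y → x ≡ y
EvenZ-≡ x≡y = Σ-≡,≡→≡ (x≡y , ≡-irrelevant _ _)

restrictToEven : ∀ {n} (γ : Fin n ↔ Fin n) → ParityPreserving γ → EvenZ n ↔ EvenZ n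
restrictToEven γ γ-pp =
  mk↔ₛ′ (λ (x , x-even) → to γ x , trans (mod-% (γ-pp x)) x-even)
        (λ (y , y-even) → from γ y , from-even y y-even)
        (λ (y , _) → EvenZ-≡ (strictlyInverseˡ γ y))
        (λ (x , _) → EvenZ-≡ (strictlyInverseʳ γ x))
  where
  from-even : ∀ y → IsEven y → IsEven (from γ y)
  from-even y y-even =
    trans (sym (mod-% (γ-pp (from γ y)))) (subst IsEven (sym (strictlyInverseˡ γ y)) y-even)

module Residues (k : ℕ) where

  N : ℕ
  N = suc k

  open ≡-mod-Reasoning

  sub+x≡y : (x y : Fin N) → toℕ (sub x y) + toℕ x ≡ toℕ y [mod N ]
  sub+x≡y x y = begin
    toℕ (sub x y) + toℕ x          ≈⟨ +-congʳ-mod (toℕ x) (toℕ-mod (toℕ y + (N ∸ toℕ x))) ⟩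
    toℕ y + (N ∸ toℕ x) + toℕ x    ≡⟨ +-assoc (toℕ y) _ _ ⟩
    toℕ y + (N ∸ toℕ x + toℕ x)    ≡⟨ cong (toℕ y +_) (m∸n+n≡m (toℕ≤n x)) ⟩
    toℕ y + N                      ≈⟨ +d-≡-mod (toℕ y) ⟩
    toℕ y                          ∎

  sub-unique : (x y z : Fin N) → toℕ z + toℕ x ≡ toℕ y [mod N ] → sub x y ≡ z
  sub-unique x y z z+x≡y = ≡-mod⇒≡ _ _ (+-cancelʳ-mod (toℕ≤n x) (begin
    toℕ (sub x y) + toℕ x  ≈⟨ sub+x≡y x y ⟩
    toℕ y                  ≈⟨ z+x≡y ⟨
    toℕ z + toℕ x          ∎))

  neg-sub : (u v : Fin N) → neg (sub u v) ≡ sub v u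
  neg-sub u v = sub-unique (sub u v) zero (sub v u) (+-cancelʳ-mod (toℕ≤n u) (begin
    toℕ (sub v u) + toℕ (sub u v) + toℕ u    ≡⟨ +-assoc (toℕ (sub v u)) _ _ ⟩
    toℕ (sub v u) + (toℕ (sub u v) + toℕ u)  ≈⟨ +-congˡ-mod (toℕ (sub v u)) (sub+x≡y u v) ⟩
    toℕ (sub v u) + toℕ v                    ≈⟨ sub+x≡y v u ⟩
    toℕ u                                    ∎))

  Cay-symmetric : ∀ {S} → InverseClosed S → ∀ u v → _~_ (Cay N S) u v → _~_ (Cay N S) v u
  Cay-symmetric {S} inverse-closed u v v-u∈S =
    subst (_∈ S) (neg-sub u v) (inverse-closed _ v-u∈S)

  shift : ℕ → Fin N → Fin N
  shift c x = (toℕ x + c) mod N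

  shift-zero : ∀ x → shift (toℕ x) zero ≡ x
  shift-zero x = ≡-mod⇒≡ _ _ (toℕ-mod (toℕ x))

  shift-inverse : ∀ {a b} → a + b ≡ N → ∀ x → shift b (shift a x) ≡ x
  shift-inverse {a} {b} a+b≡N x = ≡-mod⇒≡ _ _ (begin
    toℕ (shift b (shift a x))  ≈⟨ toℕ-mod _ ⟩
    toℕ (shift a x) + b        ≈⟨ +-congʳ-mod b (toℕ-mod (toℕ x + a)) ⟩
    toℕ x + a + b              ≡⟨ +-assoc (toℕ x) a b ⟩
    toℕ x + (a + b)            ≡⟨ cong (toℕ x +_) a+b≡N ⟩
    toℕ x + N                  ≈⟨ +d-≡-mod (toℕ x) ⟩
    toℕ x                      ∎)

  shift↔ : ∀ a b → a + b ≡ N → Fin N ↔ Fin N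
  shift↔ a b a+b≡N =
    mk↔ₛ′ (shift a) (shift b) (shift-inverse (trans (+-comm b a) a+b≡N)) (shift-inverse a+b≡N)

  sub-shift : ∀ c u v → sub (shift c u) (shift c v) ≡ sub u v
  sub-shift c u v = sub-unique _ _ _ (begin
    toℕ (sub u v) + toℕ (shift c u)  ≈⟨ +-congˡ-mod (toℕ (sub u v)) (toℕ-mod (toℕ u + c)) ⟩
    toℕ (sub u v) + (toℕ u + c)      ≡⟨ +-assoc (toℕ (sub u v)) _ c ⟨
    toℕ (sub u v) + toℕ u + c        ≈⟨ +-congʳ-mod c (sub+x≡y u v) ⟩
    toℕ v + c                        ≈⟨ toℕ-mod _ ⟨
    toℕ (shift c v)                  ∎)

  translation : ∀ (S : Subset N) a b → a + b ≡ N → Aut (Cay N S)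
  translation S a b a+b≡N = record
    { perm     = shift↔ a b a+b≡N
    ; preserve = λ u v → subst (_∈ S) (sym (sub-shift a u v)) , subst (_∈ S) (sub-shift a u v)
    }

  module _ (2∣N : 2 ∣ N) where

    sub-even : ∀ (x y : Fin N) → IsEven x → IsEven y → IsEven (sub x y)
    sub-even x y x-even y-even = mod-% (begin
      toℕ (sub x y)          ≡⟨ +-identityʳ _ ⟨
      toℕ (sub x y) + 0      ≈⟨ +-congˡ-mod (toℕ (sub x y)) x≡0 ⟨
      toℕ (sub x y) + toℕ x  ≈⟨ ≡-mod-divisor 2∣N (sub+x≡y x y) ⟩
      toℕ y                  ≈⟨ y≡0 ⟩
      0                      ∎)
      where
      x≡0 : toℕ x ≡ 0 [mod 2 ]
      x≡0 = mk-mod x-even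
      y≡0 : toℕ y ≡ 0 [mod 2 ]
      y≡0 = mk-mod y-even

    conj-parityPreserving : ∀ {a b} (a+b≡N : a + b ≡ N) γ → ParityPreserving γ →
      ParityPreserving (↔-sym (shift↔ a b a+b≡N) ↔-∘ (γ ↔-∘ shift↔ a b a+b≡N))
    conj-parityPreserving {a} {b} a+b≡N γ γ-pp x = begin
      toℕ (shift b (to γ (shift a x)))  ≈⟨ ≡-mod-divisor 2∣N (toℕ-mod _) ⟩
      toℕ (to γ (shift a x)) + b        ≈⟨ +-congʳ-mod b (γ-pp (shift a x)) ⟩
      toℕ (shift a x) + b               ≈⟨ ≡-mod-divisor 2∣N (toℕ-mod _) ⟨
      toℕ (shift b (shift a x))         ≡⟨ cong toℕ (shift-inverse a+b≡N x) ⟩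
      toℕ x                             ∎

module CirculantTF (k : ℕ) (2∣N : 2 ∣ suc k) (S : Subset (suc k)) (inverse-closed : InverseClosed S)
  where
  open Residues k

  Γ Δ : Graph
  Γ = Cay N S
  Δ = CayEven N S

  Δ-symmetric : ∀ u v → _~_ Δ u v → _~_ Δ v u
  Δ-symmetric (u , u-even) (v , v-even) (v-u∈S , _) =
    Cay-symmetric inverse-closed u v v-u∈S , sub-even 2∣N v u v-even u-even

  module _ (stable : Stable Δ) (t : TFMorphism Γ)
           (α-pp : ParityPreserving (α t)) (β-pp : ParityPreserving (β t)) where

    private
      αₑ βₑ : EvenZ N ↔ EvenZ N
      αₑ = restrictToEven (α t) α-pp
      βₑ = restrictToEven (β t) β-pp

      αₑ~βₑ : ∀ u v → _~_ Δ u v → _~_ Δ (to αₑ u) (to βₑ v)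
      αₑ~βₑ (u , u-even) (v , v-even) (v-u∈S , _) =
        hom t u v v-u∈S ,
        sub-even 2∣N (to (α t) u) (to (β t) v) (proj₂ (to αₑ (u , u-even))) (proj₂ (to βₑ (v , v-even)))

      αₑ~βₑ⇒~ : ∀ u v → _~_ Δ (to αₑ u) (to βₑ v) → _~_ Δ u v
      αₑ~βₑ⇒~ (u , u-even) (v , v-even) (β-α∈S , _) =
        tf-reflects Γ ↔-refl (λ x y → sub x y ∈? S) t u v β-α∈S , sub-even 2∣N u v u-even v-even

    agree-on-evens : ∀ x → IsEven x → to (α t) x ≡ to (β t) x
    agree-on-evens x x-even =
      cong proj₁ (stable⇒twofold-trivial Δ Δ-symmetric αₑ βₑ αₑ~βₑ αₑ~βₑ⇒~ stable (x , x-even))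

  -- Conjugating by the translation 0 ↦ x turns agreement at the even residue 0 into agreement at x.
  stable⇒parityPreserving-trivial : Stable Δ → (t : TFMorphism Γ) →
    ParityPreserving (α t) → ParityPreserving (β t) → ∀ x → to (α t) x ≡ to (β t) x
  stable⇒parityPreserving-trivial stable t α-pp β-pp x = begin
    to (α t) x                                   ≡⟨ cong (to (α t)) (shift-zero x) ⟨
    to (α t) (shift a zero)                      ≡⟨ shift-inverse b+a≡N (to (α t) (shift a zero)) ⟨
    shift a (shift b (to (α t) (shift a zero)))  ≡⟨ cong (shift a) agree-at-zero ⟩
    shift a (shift b (to (β t) (shift a zero)))  ≡⟨ shift-inverse b+a≡N (to (β t) (shift a zero)) ⟩
    to (β t) (shift a zero)                      ≡⟨ cong (to (β t)) (shift-zero x) ⟩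
    to (β t) x                                   ∎
    where
    open ≡-Reasoning
    a b : ℕ
    a = toℕ x
    b = N ∸ toℕ x
    a+b≡N : a + b ≡ N
    a+b≡N = m+[n∸m]≡n (toℕ≤n x)
    b+a≡N : b + a ≡ N
    b+a≡N = m∸n+n≡m (toℕ≤n x)
    agree-at-zero : shift b (to (α t) (shift a zero)) ≡ shift b (to (β t) (shift a zero))
    agree-at-zero = agree-on-evens stable (conjugate (translation S a b a+b≡N) t)
      (conj-parityPreserving 2∣N a+b≡N (α t) α-pp)
      (conj-parityPreserving 2∣N a+b≡N (β t) β-pp) zero refl

proposition8p3 : (m : ℕ) → m ≥ 1 → (S : Subset (2 * m)) → IsConnectionSet S →
    Unstable (Cay (2 * m) S) → Stable (CayEven (2 * m) S) → TypeII (2 * m) S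
proposition8p3 (suc m) _ S (inverse-closed , _) _ stable t α≢β (α-onto , β-onto) =
  α≢β (stable⇒parityPreserving-trivial stable t
        (mapsEvenOnto⇒parityPreserving (α t) α-onto)
        (mapsEvenOnto⇒parityPreserving (β t) β-onto))
  where open CirculantTF (m + suc (m + 0)) (m∣m*n (suc m)) S inverse-closed
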